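{- Let $G$ be a connected graph and let $x,y\in V(G)$. Every shortest path between $x$ and $y$ in $G$ contains only edges from a single equivalence class of $\mathcal{C}_G$.
   Context: A quasi-transitive $2$-edge-colouring of a graph $G$ is a map $c: E(G)\to\{R,B\}$ such that for all pairs of edges $xy, yz \in E(G)$ with $c(xy)\neq c(yz)$, we have $xz\in E(G)$. $\mathcal{C}_G$ is the equivalence relation on $E(G)$ with $e\sim f$ iff $c(e)=c(f)$ for every quasi-transitive $2$-edge-colouring $c$ of $G$. -}

module Defs where

open import Data.Nat using (ℕ; suc; _≤_)
open import Data.Fin using (Fin; zero; suc; fromℕ; inject₁)
open import Data.Bool using (Bool; T)
open import Data.Product using (Σ; _×_; ∃)
open import Relation.Binary.PropositionalEquality using (_≡_; _≢_)
open import Relation.Nullary using (¬_)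

record Graph (n : ℕ) : Set where
  field
    adj     : Fin n → Fin n → Bool
    adj-sym : ∀ u v → adj u v ≡ adj v u
    adj-irr : ∀ u → ¬ T (adj u u)

module _ {n : ℕ} (G : Graph n) where
  open Graph G

  Adj : Fin n → Fin n → Set
  Adj u v = T (adj u v)

  -- a walk of length k (k edges) given as its sequence of k+1 vertices
  IsWalk : ∀ k → (Fin (suc k) → Fin n) → Set
  IsWalk k p = ∀ (i : Fin k) → Adj (p (inject₁ i)) (p (suc i))

  WalkFromTo : Fin n → Fin n → ∀ k → (Fin (suc k) → Fin n) → Set
  WalkFromTo x y k p = p zero ≡ x × p (fromℕ k) ≡ y × IsWalk k p

  Connected : Set
  Connected = ∀ u v → Σ ℕ λ k → Σ (Fin (suc k) → Fin n) λ p → WalkFromTo u v k p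

  IsShortestPath : Fin n → Fin n → ∀ k → (Fin (suc k) → Fin n) → Set
  IsShortestPath x y k p =
    WalkFromTo x y k p ×
    (∀ m (q : Fin (suc m) → Fin n) → WalkFromTo x y m q → k ≤ m)

data Colour : Set where
  R B : Colour

module _ {n : ℕ} (G : Graph n) where

  -- a 2-edge-colouring: the colour of the (unordered) edge uv is c u v = c v u;
  -- values on non-adjacent pairs are irrelevant.
  IsEdgeColouring : (Fin n → Fin n → Colour) → Set
  IsEdgeColouring c = ∀ u v → Adj G u v → c u v ≡ c v u

  IsQuasiTransitive : (Fin n → Fin n → Colour) → Set
  IsQuasiTransitive c =
    IsEdgeColouring c ×
    (∀ x y z → Adj G x y → Adj G y z → c x y ≢ c y z → Adj G x z)

  -- the relation C_G on edges: edges uv and u'v' are equivalent iff every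
  -- quasi-transitive 2-edge-colouring gives them the same colour
  EquivC : (u v u' v' : Fin n) → Set
  EquivC u v u' v' =
    ∀ (c : Fin n → Fin n → Colour) → IsQuasiTransitive c → c u v ≡ c u' v'

-- Two consecutive edges xy, yz of a shortest path never span a chord xz, since
-- dropping y would give a shorter walk. Hence a quasi-transitive colouring gives
-- them the same colour, and by induction along the path all its edges agree.
module Submission where

open import Defs
open import Data.Nat using (ℕ; suc; zero; _≤_; _<_; _≤?_; z≤n; s≤s)
open import Data.Nat.Properties using (≤-antisym; ≤-trans; n≤1+n; ≰⇒>; <-irrefl; m≤n⇒m≤1+n; ≤-pred)
open import Data.Fin using (Fin; suc; zero; inject₁; toℕ; fromℕ; fromℕ<)
open import Data.Fin.Properties using (toℕ-fromℕ; toℕ-inject₁; toℕ<n; toℕ-fromℕ<)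
open import Data.Product using (_,_)
open import Relation.Binary.PropositionalEquality
open import Relation.Nullary using (Dec; yes; no; ¬_)
open import Data.Empty using (⊥-elim)

_≟ᶜ_ : (a b : Colour) → Dec (a ≡ b)
R ≟ᶜ R = yes refl
R ≟ᶜ B = no (λ ())
B ≟ᶜ R = no (λ ())
B ≟ᶜ B = yes refl

-- Saturating conversion ℕ → Fin (suc k); it lets a vertex sequence Fin (suc k) → V
-- be read as ℕ → V, where deleting a vertex is easy to express.
clamp : (k : ℕ) → ℕ → Fin (suc k)
clamp k       zero    = zero
clamp zero    (suc t) = zero
clamp (suc k) (suc t) = suc (clamp k t)

clamp-toℕ : ∀ {k} (j : Fin (suc k)) → clamp k (toℕ j) ≡ j
clamp-toℕ         zero    = refl
clamp-toℕ {zero}  (suc ())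
clamp-toℕ {suc k} (suc j) = cong suc (clamp-toℕ j)

-- f with the entry at position suc t removed
skip : ∀ {A : Set} → ℕ → (ℕ → A) → ℕ → A
skip t f s with s ≤? t
... | yes _ = f s
... | no  _ = f (suc s)

skip-zero : ∀ {A : Set} t (f : ℕ → A) → skip t f 0 ≡ f 0
skip-zero t f with 0 ≤? t
... | yes _  = refl
... | no 0≰t = ⊥-elim (0≰t z≤n)

skip-last : ∀ {A : Set} k t (f : ℕ → A) → t < k → skip t f k ≡ f (suc k)
skip-last k t f t<k with k ≤? t
... | yes k≤t = ⊥-elim (<-irrefl refl (≤-trans t<k k≤t))
... | no  _   = refl

module _ {n : ℕ} (G : Graph n) where

  IsWalkℕ : ℕ → (ℕ → Fin n) → Set
  IsWalkℕ k f = ∀ t → t < k → Adj G (f t) (f (suc t))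

  isWalk⇒isWalkℕ : ∀ k (p : Fin (suc k) → Fin n) →
                   IsWalk G k p → IsWalkℕ k (λ t → p (clamp k t))
  isWalk⇒isWalkℕ k p walk t t<k =
    subst₂ (λ a b → Adj G (p a) (p b)) inject₁-i≡ suc-i≡ (walk i)
    where
    i : Fin k
    i = fromℕ< t<k
    inject₁-i≡ : inject₁ i ≡ clamp k t
    inject₁-i≡ = trans (sym (clamp-toℕ (inject₁ i)))
                       (cong (clamp k) (trans (toℕ-inject₁ i) (toℕ-fromℕ< t<k)))
    suc-i≡ : suc i ≡ clamp k (suc t)
    suc-i≡ = trans (sym (clamp-toℕ (suc i))) (cong (clamp k) (cong suc (toℕ-fromℕ< t<k)))

  walkℕ⇒walkFromTo : ∀ x y k (f : ℕ → Fin n) → f 0 ≡ x → f k ≡ y → IsWalkℕ k f →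
                     WalkFromTo G x y k (λ j → f (toℕ j))
  walkℕ⇒walkFromTo x y k f f0≡x fk≡y walk =
    f0≡x ,
    subst (λ z → f z ≡ y) (sym (toℕ-fromℕ k)) fk≡y ,
    λ i → subst (λ z → Adj G (f z) (f (suc (toℕ i)))) (sym (toℕ-inject₁ i))
                (walk (toℕ i) (toℕ<n i))

  skip-isWalkℕ : ∀ k t (f : ℕ → Fin n) → t < k → IsWalkℕ (suc k) f →
                 Adj G (f t) (f (suc (suc t))) → IsWalkℕ k (skip t f)
  skip-isWalkℕ k t f t<k walk chord s s<k with s ≤? t | suc s ≤? t
  ... | yes _   | yes _    = walk s (m≤n⇒m≤1+n s<k)
  ... | yes s≤t | no  s≮t  =
    subst (λ z → Adj G (f z) (f (suc (suc z)))) (sym (≤-antisym s≤t (≤-pred (≰⇒> s≮t)))) chord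
  ... | no  s≰t | yes s<t  = ⊥-elim (s≰t (≤-trans (n≤1+n s) s<t))
  ... | no  _   | no  _    = walk (suc s) (s≤s s<k)

  quasiTransitive-chordless : ∀ {c} → IsQuasiTransitive G c → ∀ {x y z} →
    Adj G x y → Adj G y z → ¬ Adj G x z → c x y ≡ c y z
  quasiTransitive-chordless {c} (_ , qt) {x} {y} {z} xy yz ¬xz with c x y ≟ᶜ c y z
  ... | yes same = same
  ... | no  diff = ⊥-elim (¬xz (qt x y z xy yz diff))

  shortestPath-chordless : ∀ x y k (p : Fin (suc k) → Fin n) → IsShortestPath G x y k p →
    ∀ t → suc t < k → ¬ Adj G (p (clamp k t)) (p (clamp k (suc (suc t))))
  shortestPath-chordless x y (suc k) p ((p0≡x , pk≡y , walk) , shortest) t (s≤s t<k) chord =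
    <-irrefl refl (shortest k (λ j → skip t f (toℕ j))
      (walkℕ⇒walkFromTo x y k (skip t f)
        (trans (skip-zero t f) p0≡x)
        (trans (skip-last k t f t<k) fk≡y)
        (skip-isWalkℕ k t f t<k (isWalk⇒isWalkℕ (suc k) p walk) chord)))
    where
    f : ℕ → Fin n
    f s = p (clamp (suc k) s)
    fk≡y : f (suc k) ≡ y
    fk≡y = trans (cong p (trans (cong (clamp (suc k)) (sym (toℕ-fromℕ (suc k))))
                                (clamp-toℕ (fromℕ (suc k)))))
                 pk≡y

locallyConstant⇒constant : ∀ {A : Set} k (E : ℕ → A) →
  (∀ t → suc t < k → E t ≡ E (suc t)) → ∀ s → s < k → E s ≡ E 0
locallyConstant⇒constant k E step zero    _   = refl
locallyConstant⇒constant k E step (suc s) s<k =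
  trans (sym (step s s<k)) (locallyConstant⇒constant k E step s (≤-trans (n≤1+n _) s<k))

theorem19 : ∀ {n : ℕ} (G : Graph n) → Connected G →
    ∀ (x y : Fin n) (k : ℕ) (p : Fin (suc k) → Fin n) →
    IsShortestPath G x y k p →
    ∀ (i j : Fin k) →
    EquivC G (p (inject₁ i)) (p (suc i)) (p (inject₁ j)) (p (suc j))
theorem19 {n} G _ x y k p geodesic@((_ , _ , walk) , _) i j c quasiTransitive =
  begin
    c (p (inject₁ i)) (p (suc i)) ≡⟨ sym (edgeColour-toℕ i) ⟩
    E (toℕ i)                     ≡⟨ constant (toℕ i) (toℕ<n i) ⟩
    E 0                           ≡⟨ sym (constant (toℕ j) (toℕ<n j)) ⟩
    E (toℕ j)                     ≡⟨ edgeColour-toℕ j ⟩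
    c (p (inject₁ j)) (p (suc j)) ∎
  where
  open ≡-Reasoning
  f : ℕ → Fin n
  f t = p (clamp k t)
  E : ℕ → Colour
  E t = c (f t) (f (suc t))
  walkℕ : IsWalkℕ G k f
  walkℕ = isWalk⇒isWalkℕ G k p walk
  constant : ∀ s → s < k → E s ≡ E 0
  constant = locallyConstant⇒constant k E λ t t+1<k →
    quasiTransitive-chordless G quasiTransitive
      (walkℕ t (≤-trans (n≤1+n _) t+1<k)) (walkℕ (suc t) t+1<k)
      (shortestPath-chordless G x y k p geodesic t t+1<k)
  edgeColour-toℕ : ∀ (i : Fin k) → E (toℕ i) ≡ c (p (inject₁ i)) (p (suc i))
  edgeColour-toℕ i =
    cong₂ c (cong p (trans (cong (clamp k) (sym (toℕ-inject₁ i))) (clamp-toℕ (inject₁ i))))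
            (cong p (clamp-toℕ (suc i)))
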